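{- Let $\mathfrak{d}_n$ denote the number of parity alternating derangements (PADs) of $[n]=\{1,\dots,n\}$ (with $\mathfrak{d}_0=1$), and let $d_n$ denote the number of derangements of $[n]$ (with $d_0=1$, $d_1=0$). Then for every $n\ge 1$, \[ \mathfrak{d}_n=s\,\mathfrak{d}_{n-1}+(-1)^s d_{n-s},\qquad\text{where } s=\left\lceil\tfrac{n}{2}\right\rceil=\tfrac{2n+1-(-1)^n}{4}. \]
   Context: A permutation $\sigma$ of $[n]$, in one-line notation, is a PAP if $\sigma(i)\equiv i\pmod 2$ for all $i$ (entries alternate in parity, first entry odd). A PAD is a PAP which is also a derangement ($\sigma(i)\ne i$ for all $i$). The empty permutation of $[0]$ is counted as a derangement and as a PAD. -}

module Defs where

open import Data.Nat using (ℕ; zero; suc; _%_)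
open import Data.Fin using (Fin; toℕ)
open import Data.Fin.Properties using (all?; _≟_)
open import Data.Vec using (Vec; []; _∷_; lookup)
open import Data.List using (List; []; _∷_; length; filter; concatMap; map)
open import Data.Fin using () renaming (zero to fz)
open import Data.List using (allFin) renaming (map to lmap)
open import Data.Product using (_×_)
open import Relation.Nullary using (¬_; Dec; _×-dec_; ¬?)
open import Relation.Nullary.Decidable using (_→-dec_)
open import Relation.Binary.PropositionalEquality using (_≡_; _≢_)
import Data.Nat as ℕ

-- One-line notation: a word σ = (σ(1),…,σ(n)) is stored as a vector
-- v : Vec (Fin n) n, with position i (0-based) holding σ(i+1) - 1.

words : (k n : ℕ) → List (Vec (Fin n) k)
words zero    n = [] ∷ []
words (suc k) n = concatMap (λ x → lmap (x ∷_) (words k n)) (allFin n)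

IsPerm : ∀ {n} → Vec (Fin n) n → Set
IsPerm v = ∀ i j → lookup v i ≡ lookup v j → i ≡ j

-- Parity alternating: σ(i) ≡ i (mod 2).  (Shifting both sides by 1
-- to 0-based indices does not change the congruence.)
IsPAP : ∀ {n} → Vec (Fin n) n → Set
IsPAP v = ∀ i → toℕ (lookup v i) % 2 ≡ toℕ i % 2

IsDerangement : ∀ {n} → Vec (Fin n) n → Set
IsDerangement v = ∀ i → lookup v i ≢ i

isPerm? : ∀ {n} (v : Vec (Fin n) n) → Dec (IsPerm v)
isPerm? v = all? λ i → all? λ j → (lookup v i ≟ lookup v j) →-dec (i ≟ j)

isPAP? : ∀ {n} (v : Vec (Fin n) n) → Dec (IsPAP v)
isPAP? v = all? λ i → toℕ (lookup v i) % 2 ℕ.≟ toℕ i % 2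

isDer? : ∀ {n} (v : Vec (Fin n) n) → Dec (IsDerangement v)
isDer? v = all? λ i → ¬? (lookup v i ≟ i)

derangements : ℕ → ℕ
derangements n = length (filter (λ v → isPerm? v ×-dec isDer? v) (words n n))

pads : ℕ → ℕ
pads n = length (filter (λ v → isPerm? v ×-dec (isPAP? v ×-dec isDer? v)) (words n n))

-- A PAD of [n] is a pair of derangements: one of the ⌈n/2⌉ odd positions, whose
-- values must be odd, and one of the ⌊n/2⌋ even positions, so 𝔡ₙ = d⌈n/2⌉ · d⌊n/2⌋.
-- Going from n to n + 1 only turns the factor d_k, k = ⌊n/2⌋, into
-- d_(k+1) = (k+1) d_k + (-1)^(k+1), and this is the recurrence.
--
-- The factorisation is proved by filling the positions one at a time. A pending
-- position is restricted while its own letter is unused; once that letter is used,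
-- its fixed-point condition is void. If a parity class has r restricted and j
-- unrestricted pending positions and as many unused letters, its completions are
-- counted by D r j, the number of permutations of r + j letters with no fixed point
-- among r prescribed ones, and the two parity classes are filled independently.
module Submission where

open import Data.Bool using (Bool; true; false; not; _∧_; _∨_)
open import Data.Bool.Properties
  using (∧-comm; ∧-zeroʳ; ∧-identityʳ; ∧-conicalˡ; ∧-conicalʳ; ∨-zeroʳ; ∨-conicalʳ;
         not-involutive; not-injective; not-¬)
  renaming (_≟_ to _≟ᵇ_)
open import Data.Empty using (⊥-elim)
open import Data.Fin using (Fin; zero; suc; toℕ)
open import Data.Fin.Properties using (_≟_) renaming (suc-injective to suc-injectiveᶠ)
open import Data.Integer using (ℤ; +_; _+_; _*_; _^_; -1ℤ)
open import Data.Integer.Properties using (pos-*; pos-+)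
open import Data.Integer.Solver using (module +-*-Solver)
open import Data.List as List using ([]; _∷_; length; filter; concatMap; allFin)
open import Data.List.Properties using (map-++; map-∘)
open import Data.Nat as ℕ using (ℕ; zero; suc; _∸_; _!; _%_; ⌊_/2⌋; ⌈_/2⌉)
open import Data.Nat.DivMod using ([m+n]%n≡m%n)
open import Data.Nat.ListAction using () renaming (sum to sumₗ)
open import Data.Nat.ListAction.Properties using (sum-++)
open import Data.Nat.Properties
  using (+-0-commutativeMonoid; +-*-semiring; suc-injective; +-comm; +-assoc; +-identityʳ; +-suc;
         +-cancelˡ-≡; +-cancelʳ-≡; *-identityʳ; *-comm;
         *-distribʳ-+; m+n∸n≡m; ⌊n/2⌋+⌈n/2⌉≡n)
open import Data.Nat.Solver using (module +-*-Solver)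
open import Algebra.Properties.CommutativeMonoid.Sum +-0-commutativeMonoid
  using (sum; sum-syntax; sum-cong-≗; ∑-distrib-+; sum-replicate-zero)
open import Algebra.Properties.Semiring.Sum +-*-semiring using (*-distribʳ-sum)
open import Data.Product using (_×_; _,_; proj₁; proj₂)
open import Data.Vec as Vec using (Vec; []; _∷_; lookup)
open import Data.Vec.Properties using (lookup-allFin)
open import Data.Vec.Relation.Unary.All using (All; []; _∷_)
open import Data.Vec.Relation.Unary.AllPairs using ([]; _∷_)
open import Data.Vec.Relation.Unary.Unique.Propositional using (Unique)
open import Data.Vec.Relation.Unary.Unique.Propositional.Properties using (tabulate⁺)
open import Function using (_∘_; id)
open import Relation.Binary.PropositionalEquality
  using (_≡_; _≢_; refl; sym; trans; cong; cong₂; module ≡-Reasoning)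
open import Relation.Nullary using (Dec; yes; no; does)
open import Relation.Nullary.Decidable using (dec-true; dec-false; _×-dec_)
open import Relation.Unary using (Decidable)

open import Defs

[_] : Bool → ℕ
[ true ]  = 1
[ false ] = 0

[]-injective : ∀ {a b} → [ a ] ≡ [ b ] → a ≡ b
[]-injective {true}  {true}  _ = refl
[]-injective {false} {false} _ = refl

[]-split : ∀ a b → [ a ] ≡ [ a ∧ b ] ℕ.+ [ a ∧ not b ]
[]-split true  true  = refl
[]-split true  false = refl
[]-split false b     = refl

product-both-colours : ∀ (F : Bool → ℕ) b → F true ℕ.* F false ≡ F b ℕ.* F (not b)
product-both-colours F true  = refl
product-both-colours F false = *-comm (F true) (F false)

count : ∀ {m} → (Fin m → Bool) → ℕ
count {m} p = ∑[ x < m ] [ p x ]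

count-true : ∀ {m} → count {m} (λ _ → true) ≡ m
count-true {zero}  = refl
count-true {suc m} = cong suc (count-true {m})

count-false : ∀ {m} → count {m} (λ _ → false) ≡ 0
count-false {m} = sum-replicate-zero m

count-split : ∀ {m} (p q : Fin m → Bool) → count p ≡ count (λ x → p x ∧ q x) ℕ.+ count (λ x → p x ∧ not (q x))
count-split p q =
  trans (sum-cong-≗ (λ x → []-split (p x) (q x))) (∑-distrib-+ (λ x → [ p x ∧ q x ]) (λ x → [ p x ∧ not (q x) ]))

sum-update : ∀ {m} (g h : Fin m → ℕ) x → (∀ y → y ≢ x → g y ≡ h y) → sum g ℕ.+ h x ≡ sum h ℕ.+ g x
sum-update {suc m} g h zero agree =
  trans (cong (λ s → g zero ℕ.+ s ℕ.+ h zero) (sum-cong-≗ (λ y → agree (suc y) λ ())))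
        (solve 3 (λ a s b → a :+ s :+ b := b :+ s :+ a) refl (g zero) (sum (h ∘ suc)) (h zero))
  where open Data.Nat.Solver.+-*-Solver
sum-update {suc m} g h (suc x) agree = begin
  g zero ℕ.+ sum (g ∘ suc) ℕ.+ h (suc x)   ≡⟨ +-assoc (g zero) _ _ ⟩
  g zero ℕ.+ (sum (g ∘ suc) ℕ.+ h (suc x)) ≡⟨ cong₂ ℕ._+_ (agree zero λ ()) tail-update ⟩
  h zero ℕ.+ (sum (h ∘ suc) ℕ.+ g (suc x)) ≡⟨ +-assoc (h zero) _ _ ⟨
  h zero ℕ.+ sum (h ∘ suc) ℕ.+ g (suc x)   ∎
  where
  open ≡-Reasoning
  tail-update : sum (g ∘ suc) ℕ.+ h (suc x) ≡ sum (h ∘ suc) ℕ.+ g (suc x)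
  tail-update = sum-update (g ∘ suc) (h ∘ suc) x (λ y y≢x → agree (suc y) (y≢x ∘ suc-injectiveᶠ))

count-weighted-split : ∀ {m} (p q : Fin m → Bool) (g : Fin m → ℕ) K₁ K₂ →
  (∀ x → p x ∧ q x ≡ true → g x ≡ K₁) → (∀ x → p x ∧ not (q x) ≡ true → g x ≡ K₂) →
  ∑[ x < m ] ([ p x ] ℕ.* g x) ≡ count (λ x → p x ∧ q x) ℕ.* K₁ ℕ.+ count (λ x → p x ∧ not (q x)) ℕ.* K₂
count-weighted-split {m} p q g K₁ K₂ on₁ on₂ = begin
  ∑[ x < m ] ([ p x ] ℕ.* g x)
    ≡⟨ sum-cong-≗ (λ x → trans (cong (ℕ._* g x) ([]-split (p x) (q x)))
                               (*-distribʳ-+ (g x) [ p x ∧ q x ] [ p x ∧ not (q x) ])) ⟩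
  ∑[ x < m ] ([ p x ∧ q x ] ℕ.* g x ℕ.+ [ p x ∧ not (q x) ] ℕ.* g x)
    ≡⟨ ∑-distrib-+ (λ x → [ p x ∧ q x ] ℕ.* g x) (λ x → [ p x ∧ not (q x) ] ℕ.* g x) ⟩
  ∑[ x < m ] ([ p x ∧ q x ] ℕ.* g x) ℕ.+ ∑[ x < m ] ([ p x ∧ not (q x) ] ℕ.* g x)
    ≡⟨ cong₂ ℕ._+_ (weighted _ on₁) (weighted _ on₂) ⟩
  count (λ x → p x ∧ q x) ℕ.* K₁ ℕ.+ count (λ x → p x ∧ not (q x)) ℕ.* K₂ ∎
  where
  open ≡-Reasoning
  weighted : ∀ (r : Fin m → Bool) {K} → (∀ x → r x ≡ true → g x ≡ K) → ∑[ x < m ] ([ r x ] ℕ.* g x) ≡ count r ℕ.* K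
  weighted r {K} on = trans (sum-cong-≗ pointwise) (sym (*-distribʳ-sum K (λ x → [ r x ])))
    where
    pointwise : ∀ x → [ r x ] ℕ.* g x ≡ [ r x ] ℕ.* K
    pointwise x with r x in rx
    ... | true  = cong (1 ℕ.*_) (on x rx)
    ... | false = refl

-- D r j counts the permutations of r + j letters with no fixed point among r
-- prescribed ones: follow a prescribed letter p to its image y and contract p
-- into y; a prescribed y becomes free, a free y changes nothing (D-suc-left).

D : ℕ → ℕ → ℕ
D zero          j = j !
D (suc zero)    j = j ℕ.* D zero j
D (suc (suc r)) j = suc r ℕ.* D r (suc j) ℕ.+ j ℕ.* D (suc r) j

D-suc-left : ∀ r j → D (suc r) j ≡ r ℕ.* D (r ∸ 1) (suc j) ℕ.+ j ℕ.* D r j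
D-suc-left zero    j = refl
D-suc-left (suc r) j = refl

D-suc-right : ∀ r j → D r (suc j) ≡ D (suc r) j ℕ.+ D r j
D-suc-right zero j = solve 2 (λ j f → f :+ j :* f := j :* f :+ f) refl j (j !)
  where open Data.Nat.Solver.+-*-Solver
D-suc-right (suc zero) j =
  solve 2 (λ j f → (con 1 :+ j) :* (f :+ j :* f) := (con 1 :* (f :+ j :* f) :+ j :* (j :* f)) :+ j :* f)
    refl j (j !)
  where open Data.Nat.Solver.+-*-Solver
D-suc-right (suc (suc r)) j =
  by-recurrences (D r (suc j)) (D (suc r) j) refl (D-suc-right (suc r) j) (D-suc-right r (suc j))
  where
  open Data.Nat.Solver.+-*-Solver
  by-recurrences : ∀ x y {z w v} → z ≡ suc r ℕ.* x ℕ.+ j ℕ.* y → w ≡ z ℕ.+ y → v ≡ w ℕ.+ x →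
                   suc r ℕ.* v ℕ.+ suc j ℕ.* w ≡ (suc (suc r) ℕ.* w ℕ.+ j ℕ.* z) ℕ.+ z
  by-recurrences x y refl refl refl =
    solve 4 (λ r j x y → let z = (con 1 :+ r) :* x :+ j :* y ; w = z :+ y in
      (con 1 :+ r) :* (w :+ x) :+ (con 1 :+ j) :* w := ((con 2 :+ r) :* w :+ j :* z) :+ z) refl r j x y

derangement-recurrence : ∀ m → + D (suc m) 0 ≡ + suc m * + D m 0 + -1ℤ ^ suc m
derangement-recurrence zero    = refl
derangement-recurrence (suc m) = begin
  + D (suc (suc m)) 0                             ≡⟨ cong +_ D-suc-suc ⟩
  + (suc m ℕ.* (D (suc m) 0 ℕ.+ D m 0))           ≡⟨ pos-* (suc m) _ ⟩
  + suc m * + (D (suc m) 0 ℕ.+ D m 0)             ≡⟨ cong (+ suc m *_) (pos-+ (D (suc m) 0) (D m 0)) ⟩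
  + suc m * (+ D (suc m) 0 + + D m 0)             ≡⟨ from-previous (+ m) _ (+ D m 0) _ (derangement-recurrence m) ⟩
  + suc (suc m) * + D (suc m) 0 + -1ℤ ^ suc (suc m) ∎
  where
  open ≡-Reasoning
  open Data.Integer.Solver.+-*-Solver
  from-previous : ∀ μ A B e → A ≡ (+ 1 + μ) * B + e → (+ 1 + μ) * (A + B) ≡ (+ 1 + (+ 1 + μ)) * A + -1ℤ * e
  from-previous μ A B e refl = solve 3 (λ μ B e → let A = (con (+ 1) :+ μ) :* B :+ e in
    (con (+ 1) :+ μ) :* (A :+ B) := (con (+ 1) :+ (con (+ 1) :+ μ)) :* A :+ con -1ℤ :* e) refl μ B e
  D-suc-suc : D (suc (suc m)) 0 ≡ suc m ℕ.* (D (suc m) 0 ℕ.+ D m 0)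
  D-suc-suc = trans (+-identityʳ _) (cong (suc m ℕ.*_) (D-suc-right m 0))

-- The letter placed at a pending position either is the own letter of one of
-- the R other restricted positions or is one of A letters that are not; b says
-- whether that position is itself already unrestricted.
D-first-position : ∀ b R J A → A ℕ.+ [ not b ] ≡ suc J →
                   R ℕ.* D (R ∸ 1) (suc J) ℕ.+ A ℕ.* D R J ≡ D ([ not b ] ℕ.+ R) ([ b ] ℕ.+ J)
D-first-position false R J A A+1≡1+J
  rewrite suc-injective (trans (+-comm 1 A) A+1≡1+J) = sym (D-suc-left R J)
D-first-position true R J A A+0≡1+J
  rewrite trans (sym (+-identityʳ A)) A+0≡1+J = begin
  R ℕ.* D (R ∸ 1) (suc J) ℕ.+ (D R J ℕ.+ J ℕ.* D R J)
    ≡⟨ solve 3 (λ a d e → a :+ (d :+ e) := a :+ e :+ d) refl (R ℕ.* D (R ∸ 1) (suc J)) (D R J) (J ℕ.* D R J) ⟩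
  R ℕ.* D (R ∸ 1) (suc J) ℕ.+ J ℕ.* D R J ℕ.+ D R J
    ≡⟨ cong (ℕ._+ D R J) (D-suc-left R J) ⟨
  D (suc R) J ℕ.+ D R J
    ≡⟨ D-suc-right R J ⟨
  D R (suc J) ∎
  where
  open ≡-Reasoning
  open Data.Nat.Solver.+-*-Solver

sumₗ-tabulate : ∀ {A : Set} {m} (t : Fin m → A) (h : A → ℕ) →
                sumₗ (List.map h (List.tabulate t)) ≡ ∑[ i < m ] h (t i)
sumₗ-tabulate {m = zero}  t h = refl
sumₗ-tabulate {m = suc m} t h = cong (h (t zero) ℕ.+_) (sumₗ-tabulate (t ∘ suc) h)

sumₗ-words-suc : ∀ k n (g : Vec (Fin n) (suc k) → ℕ) →
  sumₗ (List.map g (words (suc k) n)) ≡ ∑[ x < n ] sumₗ (List.map (g ∘ (x ∷_)) (words k n))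
sumₗ-words-suc k n g =
  trans (by-first-letter (allFin n)) (sumₗ-tabulate id (λ x → sumₗ (List.map (g ∘ (x ∷_)) (words k n))))
  where
  by-first-letter : ∀ xs → sumₗ (List.map g (concatMap (λ x → List.map (x ∷_) (words k n)) xs))
                         ≡ sumₗ (List.map (λ x → sumₗ (List.map (g ∘ (x ∷_)) (words k n))) xs)
  by-first-letter []       = refl
  by-first-letter (x ∷ xs) = begin
    sumₗ (List.map g (List.map (x ∷_) W List.++ rest))
      ≡⟨ cong sumₗ (map-++ g (List.map (x ∷_) W) rest) ⟩
    sumₗ (List.map g (List.map (x ∷_) W) List.++ List.map g rest)
      ≡⟨ sum-++ (List.map g (List.map (x ∷_) W)) _ ⟩
    sumₗ (List.map g (List.map (x ∷_) W)) ℕ.+ sumₗ (List.map g rest)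
      ≡⟨ cong₂ ℕ._+_ (cong sumₗ (sym (map-∘ W))) (by-first-letter xs) ⟩
    sumₗ (List.map (g ∘ (x ∷_)) W) ℕ.+ sumₗ (List.map (λ x → sumₗ (List.map (g ∘ (x ∷_)) W)) xs) ∎
    where
    open ≡-Reasoning
    W = words k n
    rest = concatMap (λ x → List.map (x ∷_) W) xs

sumₗ-∧ : ∀ {A : Set} a (p : A → Bool) xs →
         sumₗ (List.map (λ w → [ a ∧ p w ]) xs) ≡ [ a ] ℕ.* sumₗ (List.map ([_] ∘ p) xs)
sumₗ-∧ true  p xs       = sym (+-identityʳ _)
sumₗ-∧ false p []       = refl
sumₗ-∧ false p (x ∷ xs) = sumₗ-∧ false p xs

length-filter : ∀ {A : Set} {P : A → Set} (P? : Decidable P) (b : A → Bool) → (∀ a → does (P? a) ≡ b a) →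
  ∀ xs → length (filter P? xs) ≡ sumₗ (List.map ([_] ∘ b) xs)
length-filter P? b agree []       = refl
length-filter P? b agree (x ∷ xs) with does (P? x) | agree x
... | true  | eq rewrite sym eq = cong suc (length-filter P? b agree xs)
... | false | eq rewrite sym eq = length-filter P? b agree xs

does≡ : ∀ {A : Set} (a? : Dec A) {b : Bool} → (A → b ≡ true) → (b ≡ true → A) → does a? ≡ b
does≡ (yes a) to from = sym (to a)
does≡ (no ¬a) {false} to from = refl
does≡ (no ¬a) {true}  to from = ⊥-elim (¬a (from refl))

-- Positions are named by their own letters, u marks the letters already used,
-- and a word must keep the colour of each position.
module Admissible {n : ℕ} (colour : Fin n → Bool) where

  _==_ : Fin n → Fin n → Bool
  x == y = does (x ≟ y)

  hasColour : Bool → Fin n → Bool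
  hasColour b x = does (colour x ≟ᵇ b)

  use : (Fin n → Bool) → Fin n → Fin n → Bool
  use u x y = (y == x) ∨ u y

  allowed : (Fin n → Bool) → Fin n → Fin n → Bool
  allowed u f x = not (x == f) ∧ (hasColour (colour f) x ∧ not (u x))

  admissible : ∀ {k} → (Fin n → Bool) → Vec (Fin n) k → Vec (Fin n) k → Bool
  admissible u []       []      = true
  admissible u (f ∷ fs) (x ∷ w) = allowed u f x ∧ admissible (use u x) fs w

  #admissible : ∀ {k} → (Fin n → Bool) → Vec (Fin n) k → ℕ
  #admissible {k} u fs = sumₗ (List.map ([_] ∘ admissible u fs) (words k n))

  _∈ᵇ_ : ∀ {k} → Fin n → Vec (Fin n) k → Bool
  x ∈ᵇ []       = false
  x ∈ᵇ (f ∷ fs) = (x == f) ∨ (x ∈ᵇ fs)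

  available : (Fin n → Bool) → Bool → ℕ
  available u b = count (λ y → hasColour b y ∧ not (u y))

  positions : ∀ {k} → Vec (Fin n) k → Bool → ℕ
  positions fs b = count (λ y → hasColour b y ∧ y ∈ᵇ fs)

  restricted unrestricted : ∀ {k} → (Fin n → Bool) → Vec (Fin n) k → Bool → ℕ
  restricted   u fs b = count (λ y → (hasColour b y ∧ y ∈ᵇ fs) ∧ not (u y))
  unrestricted u fs b = count (λ y → (hasColour b y ∧ y ∈ᵇ fs) ∧ u y)

  factor : ∀ {k} → (Fin n → Bool) → Vec (Fin n) k → Bool → ℕ
  factor u fs b = D (restricted u fs b) (unrestricted u fs b)

  ==-refl : ∀ x → (x == x) ≡ true
  ==-refl x = dec-true (x ≟ x) refl

  ==-≢ : ∀ {x y} → x ≢ y → (x == y) ≡ false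
  ==-≢ {x} {y} = dec-false (x ≟ y)

  hasColour-≡ : ∀ {b x} → colour x ≡ b → hasColour b x ≡ true
  hasColour-≡ {b} {x} = dec-true (colour x ≟ᵇ b)

  hasColour-not : ∀ {b x} → colour x ≡ b → hasColour (not b) x ≡ false
  hasColour-not {b} {x} e = dec-false (colour x ≟ᵇ not b) (not-¬ e)

  ∉⇒∈ᵇ-false : ∀ {k x} {fs : Vec (Fin n) k} → All (x ≢_) fs → x ∈ᵇ fs ≡ false
  ∉⇒∈ᵇ-false []             = refl
  ∉⇒∈ᵇ-false (x≢f ∷ x∉fs) rewrite ==-≢ x≢f = ∉⇒∈ᵇ-false x∉fs

  ∈ᵇ-lookup : ∀ {k} (fs : Vec (Fin n) k) i → lookup fs i ∈ᵇ fs ≡ true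
  ∈ᵇ-lookup (f ∷ fs) zero    rewrite ==-refl f = refl
  ∈ᵇ-lookup (f ∷ fs) (suc i) = trans (cong (_ ∨_) (∈ᵇ-lookup fs i)) (∨-zeroʳ _)

  count-∷ : ∀ {k f} {fs : Vec (Fin n) k} → All (f ≢_) fs → (φ : Fin n → Bool → Bool) → (∀ y → φ y false ≡ false) →
            count (λ y → φ y (y ∈ᵇ (f ∷ fs))) ≡ [ φ f true ] ℕ.+ count (λ y → φ y (y ∈ᵇ fs))
  count-∷ {f = f} {fs} f∉fs φ φ-false = begin
    before                                               ≡⟨ +-identityʳ before ⟨
    before ℕ.+ 0                                         ≡⟨ cong ((before ℕ.+_) ∘ [_]) φ-f-∉ ⟨
    before ℕ.+ [ φ f (f ∈ᵇ fs) ]                         ≡⟨ sum-update _ _ f agree ⟩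
    after ℕ.+ [ φ f ((f == f) ∨ (f ∈ᵇ fs)) ]             ≡⟨ cong (λ b → after ℕ.+ [ φ f (b ∨ (f ∈ᵇ fs)) ]) (==-refl f) ⟩
    after ℕ.+ [ φ f true ]                               ≡⟨ +-comm after _ ⟩
    [ φ f true ] ℕ.+ after                               ∎
    where
    open ≡-Reasoning
    before after : ℕ
    before = count (λ y → φ y (y ∈ᵇ (f ∷ fs)))
    after  = count (λ y → φ y (y ∈ᵇ fs))
    φ-f-∉ : φ f (f ∈ᵇ fs) ≡ false
    φ-f-∉ = trans (cong (φ f) (∉⇒∈ᵇ-false f∉fs)) (φ-false f)
    agree : ∀ y → y ≢ f → [ φ y (y ∈ᵇ (f ∷ fs)) ] ≡ [ φ y (y ∈ᵇ fs) ]
    agree y y≢f rewrite ==-≢ y≢f = refl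

  count-use : ∀ (φ : Fin n → Bool → Bool) u {x} → u x ≡ false →
              count (λ y → φ y (use u x y)) ℕ.+ [ φ x false ] ≡ count (λ y → φ y (u y)) ℕ.+ [ φ x true ]
  count-use φ u {x} ux = begin
    after ℕ.+ [ φ x false ]               ≡⟨ cong ((after ℕ.+_) ∘ [_] ∘ φ x) ux ⟨
    after ℕ.+ [ φ x (u x) ]               ≡⟨ sum-update _ _ x agree ⟩
    before ℕ.+ [ φ x ((x == x) ∨ u x) ]   ≡⟨ cong (λ b → before ℕ.+ [ φ x (b ∨ u x) ]) (==-refl x) ⟩
    before ℕ.+ [ φ x true ]               ∎
    where
    open ≡-Reasoning
    before after : ℕ
    before = count (λ y → φ y (u y))
    after  = count (λ y → φ y (use u x y))
    agree : ∀ y → y ≢ x → [ φ y (use u x y) ] ≡ [ φ y (u y) ]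
    agree y y≢x rewrite ==-≢ y≢x = refl

  positions-∷ : ∀ {k f} {fs : Vec (Fin n) k} → All (f ≢_) fs → ∀ b →
                positions (f ∷ fs) b ≡ [ hasColour b f ] ℕ.+ positions fs b
  positions-∷ {f = f} {fs} f∉fs b =
    trans (count-∷ f∉fs (λ y m → hasColour b y ∧ m) (λ y → ∧-zeroʳ (hasColour b y)))
          (cong (ℕ._+ positions fs b) (cong [_] (∧-identityʳ (hasColour b f))))

  restricted-∷ : ∀ {k f} {fs : Vec (Fin n) k} → All (f ≢_) fs → ∀ u b →
                 restricted u (f ∷ fs) b ≡ [ hasColour b f ∧ not (u f) ] ℕ.+ restricted u fs b
  restricted-∷ {f = f} {fs} f∉fs u b =
    trans (count-∷ f∉fs (λ y m → (hasColour b y ∧ m) ∧ not (u y)) (λ y → cong (_∧ not (u y)) (∧-zeroʳ (hasColour b y))))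
          (cong (ℕ._+ restricted u fs b) (cong ([_] ∘ (_∧ not (u f))) (∧-identityʳ (hasColour b f))))

  unrestricted-∷ : ∀ {k f} {fs : Vec (Fin n) k} → All (f ≢_) fs → ∀ u b →
                   unrestricted u (f ∷ fs) b ≡ [ hasColour b f ∧ u f ] ℕ.+ unrestricted u fs b
  unrestricted-∷ {f = f} {fs} f∉fs u b =
    trans (count-∷ f∉fs (λ y m → (hasColour b y ∧ m) ∧ u y) (λ y → cong (_∧ u y) (∧-zeroʳ (hasColour b y))))
          (cong (ℕ._+ unrestricted u fs b) (cong ([_] ∘ (_∧ u f)) (∧-identityʳ (hasColour b f))))

  factor-∷ : ∀ {k f} {fs : Vec (Fin n) k} → All (f ≢_) fs → ∀ u b →
             factor u (f ∷ fs) b ≡ D ([ hasColour b f ∧ not (u f) ] ℕ.+ restricted u fs b)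
                                     ([ hasColour b f ∧ u f ] ℕ.+ unrestricted u fs b)
  factor-∷ f∉fs u b = cong₂ D (restricted-∷ f∉fs u b) (unrestricted-∷ f∉fs u b)

  available-use : ∀ u {x} → u x ≡ false → ∀ b → available (use u x) b ℕ.+ [ hasColour b x ] ≡ available u b
  available-use u {x} ux b = begin
    available (use u x) b ℕ.+ [ hasColour b x ]          ≡⟨ cong ((available (use u x) b ℕ.+_) ∘ [_]) (∧-identityʳ (hasColour b x)) ⟨
    available (use u x) b ℕ.+ [ hasColour b x ∧ true ]   ≡⟨ count-use (λ y t → hasColour b y ∧ not t) u ux ⟩
    available u b ℕ.+ [ hasColour b x ∧ false ]          ≡⟨ cong ((available u b ℕ.+_) ∘ [_]) (∧-zeroʳ (hasColour b x)) ⟩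
    available u b ℕ.+ 0                                  ≡⟨ +-identityʳ (available u b) ⟩
    available u b                                        ∎
    where open ≡-Reasoning

  restricted-use : ∀ u {x} → u x ≡ false → ∀ {k} (fs : Vec (Fin n) k) b →
                   restricted (use u x) fs b ℕ.+ [ hasColour b x ∧ x ∈ᵇ fs ] ≡ restricted u fs b
  restricted-use u {x} ux fs b = begin
    restricted (use u x) fs b ℕ.+ [ pending ]          ≡⟨ cong ((restricted (use u x) fs b ℕ.+_) ∘ [_]) (∧-identityʳ pending) ⟨
    restricted (use u x) fs b ℕ.+ [ pending ∧ true ]   ≡⟨ count-use (λ y t → (hasColour b y ∧ y ∈ᵇ fs) ∧ not t) u ux ⟩
    restricted u fs b ℕ.+ [ pending ∧ false ]          ≡⟨ cong ((restricted u fs b ℕ.+_) ∘ [_]) (∧-zeroʳ pending) ⟩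
    restricted u fs b ℕ.+ 0                            ≡⟨ +-identityʳ (restricted u fs b) ⟩
    restricted u fs b                                  ∎
    where
    open ≡-Reasoning
    pending = hasColour b x ∧ x ∈ᵇ fs

  unrestricted-use : ∀ u {x} → u x ≡ false → ∀ {k} (fs : Vec (Fin n) k) b →
                     unrestricted (use u x) fs b ≡ [ hasColour b x ∧ x ∈ᵇ fs ] ℕ.+ unrestricted u fs b
  unrestricted-use u {x} ux fs b = begin
    unrestricted (use u x) fs b                         ≡⟨ +-identityʳ _ ⟨
    unrestricted (use u x) fs b ℕ.+ 0                   ≡⟨ cong ((unrestricted (use u x) fs b ℕ.+_) ∘ [_]) (∧-zeroʳ pending) ⟨
    unrestricted (use u x) fs b ℕ.+ [ pending ∧ false ] ≡⟨ count-use (λ y t → (hasColour b y ∧ y ∈ᵇ fs) ∧ t) u ux ⟩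
    unrestricted u fs b ℕ.+ [ pending ∧ true ]          ≡⟨ cong ((unrestricted u fs b ℕ.+_) ∘ [_]) (∧-identityʳ pending) ⟩
    unrestricted u fs b ℕ.+ [ pending ]                 ≡⟨ +-comm (unrestricted u fs b) _ ⟩
    [ pending ] ℕ.+ unrestricted u fs b                 ∎
    where
    open ≡-Reasoning
    pending = hasColour b x ∧ x ∈ᵇ fs

  factor-use : ∀ u {x} → u x ≡ false → ∀ {k} (fs : Vec (Fin n) k) b →
               factor (use u x) fs b ≡ D (restricted u fs b ∸ [ hasColour b x ∧ x ∈ᵇ fs ])
                                         ([ hasColour b x ∧ x ∈ᵇ fs ] ℕ.+ unrestricted u fs b)
  factor-use u {x} ux fs b = cong₂ D
    (trans (sym (m+n∸n≡m _ [ hasColour b x ∧ x ∈ᵇ fs ])) (cong (_∸ [ hasColour b x ∧ x ∈ᵇ fs ]) (restricted-use u ux fs b)))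
    (unrestricted-use u ux fs b)

  positions-split : ∀ u {k} (fs : Vec (Fin n) k) b → positions fs b ≡ restricted u fs b ℕ.+ unrestricted u fs b
  positions-split u fs b = trans (count-split _ u) (+-comm (unrestricted u fs b) (restricted u fs b))

  factor-[] : ∀ u b → factor u [] b ≡ 1
  factor-[] u b = cong₂ D (noPositions (not ∘ u)) (noPositions u)
    where
    noPositions : ∀ v → count (λ y → (hasColour b y ∧ false) ∧ v y) ≡ 0
    noPositions v = trans (sum-cong-≗ (λ y → cong ([_] ∘ (_∧ v y)) (∧-zeroʳ (hasColour b y)))) (count-false {n})

  allowed⇒ : ∀ {u f x} → allowed u f x ≡ true → x ≢ f × colour x ≡ colour f × u x ≡ false
  allowed⇒ {u} {f} {x} ok with x ≟ f | colour x ≟ᵇ colour f | u x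
  ... | no x≢f | yes same | false = x≢f , same , refl

  ⇒allowed : ∀ {u f x} → x ≢ f → colour x ≡ colour f → u x ≡ false → allowed u f x ≡ true
  ⇒allowed x≢f same ux rewrite ==-≢ x≢f | hasColour-≡ same | ux = refl

  #admissible-∷ : ∀ {k} u f (fs : Vec (Fin n) k) →
                  #admissible u (f ∷ fs) ≡ ∑[ x < n ] ([ allowed u f x ] ℕ.* #admissible (use u x) fs)
  #admissible-∷ {k} u f fs = trans (sumₗ-words-suc k n ([_] ∘ admissible u (f ∷ fs)))
    (sum-cong-≗ (λ x → sumₗ-∧ (allowed u f x) (admissible (use u x) fs) (words k n)))

  module FirstPosition {k} (u : Fin n → Bool) (f : Fin n) (fs : Vec (Fin n) k) (f∉fs : All (f ≢_) fs)
                       (balanced : ∀ b → available u b ≡ positions (f ∷ fs) b) where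

    b₀ : Bool
    b₀ = colour f

    R J A : ℕ
    R = restricted u fs b₀
    J = unrestricted u fs b₀
    A = count (λ x → allowed u f x ∧ not (x ∈ᵇ fs))

    O : ℕ
    O = factor u fs (not b₀)

    f-own : hasColour b₀ f ≡ true
    f-own = hasColour-≡ refl

    balanced-use : ∀ {x} → allowed u f x ≡ true → ∀ b → available (use u x) b ≡ positions fs b
    balanced-use {x} ok b with allowed⇒ {u} {f} {x} ok
    ... | _ , same , ux = +-cancelʳ-≡ [ hasColour b f ] _ _ (begin
      available (use u x) b ℕ.+ [ hasColour b f ] ≡⟨ cong ((available (use u x) b ℕ.+_) ∘ [_] ∘ does ∘ (_≟ᵇ b)) same ⟨
      available (use u x) b ℕ.+ [ hasColour b x ] ≡⟨ available-use u ux b ⟩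
      available u b                               ≡⟨ balanced b ⟩
      positions (f ∷ fs) b                        ≡⟨ positions-∷ f∉fs b ⟩
      [ hasColour b f ] ℕ.+ positions fs b        ≡⟨ +-comm [ hasColour b f ] _ ⟩
      positions fs b ℕ.+ [ hasColour b f ]        ∎)
      where open ≡-Reasoning

    #allowed : count (allowed u f) ℕ.+ [ not (u f) ] ≡ available u b₀
    #allowed = begin
      count (allowed u f) ℕ.+ [ not (u f) ]              ≡⟨ cong ((count (allowed u f) ℕ.+_) ∘ [_] ∘ (_∧ not (u f))) f-own ⟨
      count (allowed u f) ℕ.+ [ hasColour b₀ f ∧ not (u f) ] ≡⟨ sum-update _ _ f agree ⟩
      available u b₀ ℕ.+ [ allowed u f f ]                ≡⟨ cong ((available u b₀ ℕ.+_) ∘ [_] ∘ (_∧ _) ∘ not) (==-refl f) ⟩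
      available u b₀ ℕ.+ 0                                ≡⟨ +-identityʳ _ ⟩
      available u b₀                                      ∎
      where
      open ≡-Reasoning
      agree : ∀ y → y ≢ f → [ allowed u f y ] ≡ [ hasColour b₀ y ∧ not (u y) ]
      agree y y≢f rewrite ==-≢ y≢f = refl

    #allowed-pending : count (λ x → allowed u f x ∧ x ∈ᵇ fs) ≡ R
    #allowed-pending = sum-cong-≗ (cong [_] ∘ pointwise)
      where
      swap : ∀ a m v → (a ∧ v) ∧ m ≡ (a ∧ m) ∧ v
      swap true  m v = ∧-comm v m
      swap false m v = refl
      pointwise : ∀ x → allowed u f x ∧ x ∈ᵇ fs ≡ (hasColour b₀ x ∧ x ∈ᵇ fs) ∧ not (u x)
      pointwise x with x ≟ f
      ... | yes refl rewrite ∉⇒∈ᵇ-false f∉fs = cong (_∧ not (u x)) (sym (∧-zeroʳ (hasColour b₀ x)))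
      ... | no _     = swap (hasColour b₀ x) (x ∈ᵇ fs) (not (u x))

    #allowed-fresh : A ℕ.+ [ not (u f) ] ≡ suc J
    #allowed-fresh = +-cancelˡ-≡ R _ _ (begin
      R ℕ.+ (A ℕ.+ [ not (u f) ])  ≡⟨ +-assoc R A _ ⟨
      R ℕ.+ A ℕ.+ [ not (u f) ]    ≡⟨ cong (λ r → r ℕ.+ A ℕ.+ [ not (u f) ]) #allowed-pending ⟨
      count (λ x → allowed u f x ∧ x ∈ᵇ fs) ℕ.+ A ℕ.+ [ not (u f) ]
                                   ≡⟨ cong (ℕ._+ [ not (u f) ]) (count-split (allowed u f) (_∈ᵇ fs)) ⟨
      count (allowed u f) ℕ.+ [ not (u f) ] ≡⟨ #allowed ⟩
      available u b₀               ≡⟨ balanced b₀ ⟩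
      positions (f ∷ fs) b₀        ≡⟨ positions-∷ f∉fs b₀ ⟩
      [ hasColour b₀ f ] ℕ.+ positions fs b₀ ≡⟨ cong (λ c → [ c ] ℕ.+ positions fs b₀) f-own ⟩
      suc (positions fs b₀)        ≡⟨ cong suc (positions-split u fs b₀) ⟩
      suc (R ℕ.+ J)                ≡⟨ +-suc R J ⟨
      R ℕ.+ suc J                  ∎)
      where open ≡-Reasoning

    factors-use : ∀ {x} → allowed u f x ≡ true →
                  factor (use u x) fs b₀ ℕ.* factor (use u x) fs (not b₀) ≡ D (R ∸ [ x ∈ᵇ fs ]) ([ x ∈ᵇ fs ] ℕ.+ J) ℕ.* O
    factors-use {x} ok with allowed⇒ {u} {f} {x} ok
    ... | _ , same , ux = cong₂ ℕ._*_
      (trans (factor-use u ux fs b₀) (cong (λ c → D (R ∸ [ c ∧ x ∈ᵇ fs ]) ([ c ∧ x ∈ᵇ fs ] ℕ.+ J)) (hasColour-≡ same)))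
      (trans (factor-use u ux fs (not b₀))
             (cong (λ c → D (restricted u fs (not b₀) ∸ [ c ∧ x ∈ᵇ fs ]) ([ c ∧ x ∈ᵇ fs ] ℕ.+ unrestricted u fs (not b₀)))
                   (hasColour-not same)))

    factors-∷ : factor u (f ∷ fs) b₀ ℕ.* factor u (f ∷ fs) (not b₀) ≡ D ([ not (u f) ] ℕ.+ R) ([ u f ] ℕ.+ J) ℕ.* O
    factors-∷ = cong₂ ℕ._*_
      (trans (factor-∷ f∉fs u b₀) (cong (λ c → D ([ c ∧ not (u f) ] ℕ.+ R) ([ c ∧ u f ] ℕ.+ J)) f-own))
      (trans (factor-∷ f∉fs u (not b₀))
             (cong (λ c → D ([ c ∧ not (u f) ] ℕ.+ restricted u fs (not b₀)) ([ c ∧ u f ] ℕ.+ unrestricted u fs (not b₀)))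
                   (hasColour-not {x = f} refl)))

    expand : (∀ {x} → allowed u f x ≡ true →
               #admissible (use u x) fs ≡ factor (use u x) fs b₀ ℕ.* factor (use u x) fs (not b₀)) →
             #admissible u (f ∷ fs) ≡ factor u (f ∷ fs) b₀ ℕ.* factor u (f ∷ fs) (not b₀)
    expand IH = begin
      #admissible u (f ∷ fs)
        ≡⟨ #admissible-∷ u f fs ⟩
      ∑[ x < n ] ([ allowed u f x ] ℕ.* #admissible (use u x) fs)
        ≡⟨ count-weighted-split (allowed u f) (_∈ᵇ fs) _ _ _ on-pending on-fresh ⟩
      count (λ x → allowed u f x ∧ x ∈ᵇ fs) ℕ.* (D (R ∸ 1) (suc J) ℕ.* O) ℕ.+ A ℕ.* (D R J ℕ.* O)
        ≡⟨ cong (λ r → r ℕ.* (D (R ∸ 1) (suc J) ℕ.* O) ℕ.+ A ℕ.* (D R J ℕ.* O)) #allowed-pending ⟩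
      R ℕ.* (D (R ∸ 1) (suc J) ℕ.* O) ℕ.+ A ℕ.* (D R J ℕ.* O)
        ≡⟨ solve 5 (λ R A a b o → R :* (a :* o) :+ A :* (b :* o) := (R :* a :+ A :* b) :* o) refl
                 R A (D (R ∸ 1) (suc J)) (D R J) O ⟩
      (R ℕ.* D (R ∸ 1) (suc J) ℕ.+ A ℕ.* D R J) ℕ.* O
        ≡⟨ cong (ℕ._* O) (D-first-position (u f) R J A #allowed-fresh) ⟩
      D ([ not (u f) ] ℕ.+ R) ([ u f ] ℕ.+ J) ℕ.* O
        ≡⟨ factors-∷ ⟨
      factor u (f ∷ fs) b₀ ℕ.* factor u (f ∷ fs) (not b₀) ∎
      where
      open ≡-Reasoning
      open Data.Nat.Solver.+-*-Solver
      after : ∀ {x} → allowed u f x ≡ true → #admissible (use u x) fs ≡ D (R ∸ [ x ∈ᵇ fs ]) ([ x ∈ᵇ fs ] ℕ.+ J) ℕ.* O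
      after ok = trans (IH ok) (factors-use ok)
      shape : Bool → ℕ
      shape m = D (R ∸ [ m ]) ([ m ] ℕ.+ J) ℕ.* O
      on-pending : ∀ x → allowed u f x ∧ x ∈ᵇ fs ≡ true → #admissible (use u x) fs ≡ D (R ∸ 1) (suc J) ℕ.* O
      on-pending x e = trans (after (∧-conicalˡ _ _ e)) (cong shape (∧-conicalʳ (allowed u f x) _ e))
      on-fresh : ∀ x → allowed u f x ∧ not (x ∈ᵇ fs) ≡ true → #admissible (use u x) fs ≡ D R J ℕ.* O
      on-fresh x e = trans (after (∧-conicalˡ _ _ e)) (cong shape (not-injective (∧-conicalʳ (allowed u f x) _ e)))

  #admissible≡factors : ∀ {k} u (fs : Vec (Fin n) k) → Unique fs → (∀ b → available u b ≡ positions fs b) →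
                        #admissible u fs ≡ factor u fs true ℕ.* factor u fs false
  #admissible≡factors u [] [] balanced = sym (cong₂ ℕ._*_ (factor-[] u true) (factor-[] u false))
  #admissible≡factors u (f ∷ fs) (f∉fs ∷ unique) balanced =
    trans (expand (λ {x} ok → trans (#admissible≡factors (use u x) fs unique (balanced-use ok))
                                    (product-both-colours (factor (use u x) fs) b₀)))
          (sym (product-both-colours (factor u (f ∷ fs)) b₀))
    where open FirstPosition u f fs f∉fs balanced

  record Fits {k} (u : Fin n → Bool) (fs w : Vec (Fin n) k) : Set where
    field
      unused     : ∀ t → u (lookup w t) ≡ false
      injective  : ∀ i j → lookup w i ≡ lookup w j → i ≡ j
      avoids     : ∀ t → lookup w t ≢ lookup fs t
      sameColour : ∀ t → colour (lookup w t) ≡ colour (lookup fs t)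

  admissible-sound : ∀ {k} u (fs w : Vec (Fin n) k) → admissible u fs w ≡ true → Fits u fs w
  admissible-sound u [] [] _ = record { unused = λ () ; injective = λ () ; avoids = λ () ; sameColour = λ () }
  admissible-sound u (f ∷ fs) (x ∷ w) ok
    with allowed⇒ {u} {f} {x} (∧-conicalˡ _ _ ok) | admissible-sound (use u x) fs w (∧-conicalʳ (allowed u f x) _ ok)
  ... | x≢f , same , ux | rest = record
    { unused     = λ { zero → ux ; (suc t) → ∨-conicalʳ _ _ (unused t) }
    ; injective  = λ { zero zero _ → refl
                     ; zero (suc j) eq → ⊥-elim (fresh j (sym eq))
                     ; (suc i) zero eq → ⊥-elim (fresh i eq)
                     ; (suc i) (suc j) eq → cong suc (injective i j eq) }
    ; avoids     = λ { zero → x≢f ; (suc t) → avoids t }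
    ; sameColour = λ { zero → same ; (suc t) → sameColour t } }
    where
    open Fits rest
    fresh : ∀ t → lookup w t ≢ x
    fresh t refl with trans (sym (cong (_∨ u x) (==-refl x))) (unused t)
    ... | ()

  admissible-complete : ∀ {k} u (fs w : Vec (Fin n) k) → Fits u fs w → admissible u fs w ≡ true
  admissible-complete u []       []      _    = refl
  admissible-complete u (f ∷ fs) (x ∷ w) fits =
    cong₂ _∧_ (⇒allowed {u} (avoids zero) (sameColour zero) (unused zero)) (admissible-complete (use u x) fs w rest)
    where
    open Fits fits
    rest : Fits (use u x) fs w
    rest = record
      { unused     = λ t → trans (cong (_∨ u (lookup w t)) (==-≢ (λ eq → fresh-index (injective (suc t) zero eq)))) (unused (suc t))
      ; injective  = λ i j eq → suc-injectiveᶠ (injective (suc i) (suc j) eq)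
      ; avoids     = avoids ∘ suc
      ; sameColour = sameColour ∘ suc }
      where
      fresh-index : ∀ {t : Fin _} → suc t ≢ zero
      fresh-index ()

  ColouredDerangement : Vec (Fin n) n → Set
  ColouredDerangement v = IsPerm v × IsDerangement v × (∀ i → colour (lookup v i) ≡ colour i)

  count-coloured-derangements : ∀ {P : Vec (Fin n) n → Set} (P? : Decidable P) →
    (∀ v → P v → ColouredDerangement v) → (∀ v → ColouredDerangement v → P v) →
    length (filter P? (words n n)) ≡ D (count (hasColour true)) 0 ℕ.* D (count (hasColour false)) 0
  count-coloured-derangements {P} P? to from = begin
    length (filter P? (words n n))
      ≡⟨ length-filter P? (admissible nothingUsed (Vec.allFin n))
                      (λ v → does≡ (P? v) (sound v) (complete v)) (words n n) ⟩
    #admissible nothingUsed (Vec.allFin n)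
      ≡⟨ #admissible≡factors nothingUsed (Vec.allFin n) (tabulate⁺ id) balanced ⟩
    factor nothingUsed (Vec.allFin n) true ℕ.* factor nothingUsed (Vec.allFin n) false
      ≡⟨ cong₂ ℕ._*_ (factor-identity true) (factor-identity false) ⟩
    D (count (hasColour true)) 0 ℕ.* D (count (hasColour false)) 0 ∎
    where
    open ≡-Reasoning
    nothingUsed : Fin n → Bool
    nothingUsed _ = false
    every : ∀ y → y ∈ᵇ Vec.allFin n ≡ true
    every y = trans (cong (_∈ᵇ Vec.allFin n) (sym (lookup-allFin y))) (∈ᵇ-lookup (Vec.allFin n) y)
    sound : ∀ v → P v → admissible nothingUsed (Vec.allFin n) v ≡ true
    sound v p with to v p
    ... | perm , der , col = admissible-complete nothingUsed (Vec.allFin n) v record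
      { unused     = λ _ → refl
      ; injective  = perm
      ; avoids     = λ t eq → der t (trans eq (lookup-allFin t))
      ; sameColour = λ t → trans (col t) (cong colour (sym (lookup-allFin t))) }
    complete : ∀ v → admissible nothingUsed (Vec.allFin n) v ≡ true → P v
    complete v ok = from v (injective , (λ t eq → avoids t (trans eq (sym (lookup-allFin t))))
                                      , (λ t → trans (sameColour t) (cong colour (lookup-allFin t))))
      where open Fits (admissible-sound nothingUsed (Vec.allFin n) v ok)
    balanced : ∀ b → available nothingUsed b ≡ positions (Vec.allFin n) b
    balanced b = sum-cong-≗ (λ y → cong ([_] ∘ (hasColour b y ∧_)) (sym (every y)))
    factor-identity : ∀ b → factor nothingUsed (Vec.allFin n) b ≡ D (count (hasColour b)) 0
    factor-identity b = cong₂ D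
      (sum-cong-≗ (λ y → cong [_] (trans (∧-identityʳ _) (trans (cong (hasColour b y ∧_) (every y)) (∧-identityʳ _)))))
      (trans (sum-cong-≗ (λ y → cong [_] (∧-zeroʳ (hasColour b y ∧ y ∈ᵇ Vec.allFin n)))) (count-false {n}))

odd : ℕ → Bool
odd zero    = false
odd (suc m) = not (odd m)

%2≡[odd] : ∀ m → m % 2 ≡ [ odd m ]
%2≡[odd] zero          = refl
%2≡[odd] (suc zero)    = refl
%2≡[odd] (suc (suc m)) = begin
  (2 ℕ.+ m) % 2         ≡⟨ cong (_% 2) (+-comm 2 m) ⟩
  (m ℕ.+ 2) % 2         ≡⟨ [m+n]%n≡m%n m 2 ⟩
  m % 2                 ≡⟨ %2≡[odd] m ⟩
  [ odd m ]             ≡⟨ cong [_] (not-involutive (odd m)) ⟨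
  [ not (not (odd m)) ] ∎
  where open ≡-Reasoning

count-odd : ∀ m → count {m} (odd ∘ toℕ) ≡ ⌊ m /2⌋ × count {m} (not ∘ odd ∘ toℕ) ≡ ⌈ m /2⌉
count-odd zero    = refl , refl
count-odd (suc m) with count-odd m
... | #odd , #even = #even , cong suc (trans (sum-cong-≗ {m} (cong [_] ∘ not-involutive ∘ odd ∘ toℕ)) #odd)

derangements≡D : ∀ m → derangements m ≡ D m 0
derangements≡D m = begin
  derangements m
    ≡⟨ count-coloured-derangements (λ v → isPerm? v ×-dec isDer? v)
                                   (λ _ (p , d) → p , d , λ _ → refl) (λ _ (p , d , _) → p , d) ⟩
  D (count {m} (λ _ → true)) 0 ℕ.* D (count {m} (λ _ → false)) 0
    ≡⟨ cong₂ (λ a b → D a 0 ℕ.* D b 0) (count-true {m}) (count-false {m}) ⟩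
  D m 0 ℕ.* 1
    ≡⟨ *-identityʳ (D m 0) ⟩
  D m 0 ∎
  where
  open ≡-Reasoning
  open Admissible {m} (λ _ → true)

pads≡D : ∀ m → pads m ≡ D ⌊ m /2⌋ 0 ℕ.* D ⌈ m /2⌉ 0
pads≡D m = begin
  pads m
    ≡⟨ count-coloured-derangements (λ v → isPerm? v ×-dec (isPAP? v ×-dec isDer? v)) to from ⟩
  D (count (hasColour true)) 0 ℕ.* D (count (hasColour false)) 0
    ≡⟨ cong₂ (λ a b → D a 0 ℕ.* D b 0) #odd #even ⟩
  D ⌊ m /2⌋ 0 ℕ.* D ⌈ m /2⌉ 0 ∎
  where
  open ≡-Reasoning
  open Admissible {m} (odd ∘ toℕ)
  parity : ∀ a b → a % 2 ≡ b % 2 → odd a ≡ odd b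
  parity a b eq = []-injective (trans (sym (%2≡[odd] a)) (trans eq (%2≡[odd] b)))
  to : ∀ v → IsPerm v × IsPAP v × IsDerangement v → ColouredDerangement v
  to v (p , pap , d) = p , d , λ i → parity (toℕ (lookup v i)) (toℕ i) (pap i)
  from : ∀ v → ColouredDerangement v → IsPerm v × IsPAP v × IsDerangement v
  from v (p , d , col) =
    p , (λ i → trans (%2≡[odd] (toℕ (lookup v i))) (trans (cong [_] (col i)) (sym (%2≡[odd] (toℕ i))))) , d
  #odd : count (hasColour true) ≡ ⌊ m /2⌋
  #odd = trans (sum-cong-≗ {m} (λ y → cong [_] (≟true (odd (toℕ y))))) (proj₁ (count-odd m))
    where
    ≟true : ∀ a → does (a ≟ᵇ true) ≡ a
    ≟true true  = refl
    ≟true false = refl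
  #even : count (hasColour false) ≡ ⌈ m /2⌉
  #even = trans (sum-cong-≗ {m} (λ y → cong [_] (≟false (odd (toℕ y))))) (proj₂ (count-odd m))
    where
    ≟false : ∀ a → does (a ≟ᵇ false) ≡ not a
    ≟false true  = refl
    ≟false false = refl

theorem4 : (n : ℕ) → let s = ⌈ suc n /2⌉ in
    + pads (suc n) ≡ + s * + pads n + (-1ℤ ^ s) * + derangements (suc n ∸ s)
theorem4 n = begin
  + pads (suc n)
    ≡⟨ cong +_ (pads≡D (suc n)) ⟩
  + (D h 0 ℕ.* D (suc k) 0)
    ≡⟨ pos-* (D h 0) _ ⟩
  + D h 0 * + D (suc k) 0
    ≡⟨ cong (+ D h 0 *_) (derangement-recurrence k) ⟩
  + D h 0 * (+ suc k * + D k 0 + e)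
    ≡⟨ solve 4 (λ p s d e → p :* (s :* d :+ e) := s :* (d :* p) :+ e :* p) refl (+ D h 0) (+ suc k) (+ D k 0) e ⟩
  + suc k * (+ D k 0 * + D h 0) + e * + D h 0
    ≡⟨ cong₂ (λ a b → + suc k * a + e * b) pads-n derangements-h ⟩
  + suc k * + pads n + e * + derangements (suc n ∸ suc k) ∎
  where
  open ≡-Reasoning
  open Data.Integer.Solver.+-*-Solver
  k h : ℕ
  k = ⌊ n /2⌋
  h = ⌊ suc n /2⌋
  e : ℤ
  e = -1ℤ ^ suc k
  pads-n : + D k 0 * + D h 0 ≡ + pads n
  pads-n = trans (sym (pos-* (D k 0) (D h 0))) (cong +_ (sym (pads≡D n)))
  derangements-h : + D h 0 ≡ + derangements (suc n ∸ suc k)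
  derangements-h = cong +_ (sym (trans (cong derangements half) (derangements≡D h)))
    where
    half : suc n ∸ suc k ≡ h
    half = trans (cong (_∸ suc k) (sym (⌊n/2⌋+⌈n/2⌉≡n (suc n)))) (m+n∸n≡m h (suc k))
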